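{- Let $r$ be a positive integer and let $G$ be a connected graph containing a set $A_0\subseteq V(G)$ which percolates with threshold $r$ in $k$ rounds. Then $k\le \operatorname{diam}_D(G)+1$, where $\operatorname{diam}_D(G)$ is the detour diameter of $G$.
   Context: Bootstrap percolation with threshold $r$: given an initially infected set $A_0$, let $I_1=A_0$ and $I_{t+1}=I_t\cup\{v\in V(G): |N(v)\cap I_t|\ge r\}$ (the initial round is round 1). $A_0$ percolates in $k$ rounds if $k$ is the least integer with $I_k=V(G)$. The detour distance $D(u,v)$ between vertices $u,v$ is the length (number of edges) of a longest $u$–$v$ path; the detour diameter $\operatorname{diam}_D(G)$ is the maximum of $D(u,v)$ over all pairs of vertices, i.e., the length of a longest path in $G$. -}

module Defs where

open import Data.Nat using (ℕ; zero; suc; _≤_; _<_; _≤ᵇ_)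
open import Data.Bool using (Bool; true; false; _∨_; _∧_)
open import Data.Fin using (Fin; inject₁; zero; suc)
open import Data.Fin.Subset using (Subset; ∣_∣; _∩_; ⊤)
open import Data.Vec using (tabulate; lookup; zipWith)
open import Data.Product using (Σ; ∃; _×_; _,_)
open import Function.Definitions using (Injective)
open import Relation.Binary.PropositionalEquality using (_≡_; _≢_)

record Graph (n : ℕ) : Set where
  field
    adj   : Fin n → Fin n → Bool
    sym   : ∀ u v → adj u v ≡ adj v u
    irrefl : ∀ v → adj v v ≡ false
open Graph public

N : ∀ {n} → Graph n → Fin n → Subset n
N G v = tabulate (λ u → adj G v u)

step : ∀ {n} → Graph n → ℕ → Subset n → Subset n
step G r I = tabulate (λ v → lookup I v ∨ (r ≤ᵇ ∣ N G v ∩ I ∣))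

-- infected set I_t, with I_1 = A0 (round 1 is the initial round);
-- I_0 is also set to A0 only as a convention (never used in the statement).
infected : ∀ {n} → Graph n → ℕ → Subset n → ℕ → Subset n
infected G r A0 zero = A0
infected G r A0 (suc zero) = A0
infected G r A0 (suc (suc t)) = step G r (infected G r A0 (suc t))

PercolatesIn : ∀ {n} → Graph n → ℕ → Subset n → ℕ → Set
PercolatesIn G r A0 k =
  1 ≤ k × infected G r A0 k ≡ ⊤ ×
  (∀ j → 1 ≤ j → j < k → infected G r A0 j ≢ ⊤)

record Path {n} (G : Graph n) (ℓ : ℕ) : Set where
  field
    vert     : Fin (suc ℓ) → Fin n
    distinct : Injective _≡_ _≡_ vert
    edges    : ∀ (i : Fin ℓ) → adj G (vert (inject₁ i)) (vert (suc i)) ≡ true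
open Path public

PathBetween : ∀ {n} (G : Graph n) → Fin n → Fin n → ℕ → Set
PathBetween G u v ℓ =
  Σ (Path G ℓ) λ p → vert p zero ≡ u × vert p (Data.Fin.fromℕ ℓ) ≡ v

Connected : ∀ {n} → Graph n → Set
Connected G = ∀ u v → ∃ λ ℓ → PathBetween G u v ℓ

-- d is the detour diameter: the length of a longest path in G
-- (equivalently the maximum over pairs u,v of the detour distance D(u,v))
IsDetourDiameter : ∀ {n} → Graph n → ℕ → Set
IsDetourDiameter G d = Path G d × (∀ ℓ → Path G ℓ → ℓ ≤ d)

{-# OPTIONS --safe #-}

-- A vertex first infected in round t + 1 has at least r ≥ 1 neighbours
-- infected by round t, but fewer than r by round t − 1 (otherwise it would
-- have been infected earlier); hence one of its neighbours was first
-- infected in round t. Starting from a vertex first infected in the last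
-- round k and descending in this way gives vertices with strictly decreasing
-- infection times, hence distinct, forming a path with k − 1 edges.
module Submission where

open import Defs hiding (sym)
open import Data.Bool using (Bool; true; T)
open import Data.Bool.Properties using (T-≡; T-∨)
open import Data.Fin using (Fin; zero; suc; toℕ; inject₁)
open import Data.Fin.Properties using (any?; toℕ-injective; toℕ≤pred[n])
open import Data.Fin.Subset using (Subset; ∣_∣; _∩_; ⊤; ⊥; _∈_; _∉_; _⊆_)
open import Data.Fin.Subset.Properties
  using (_∈?_; ⊆⊤; ⊆-antisym; p⊆q⇒∣p∣≤∣q∣; x∈p∩q⁺; x∈p∩q⁻; ∩-zeroʳ; ∣⊥∣≡0; ∈⊤)
open import Data.Nat using (ℕ; zero; suc; _+_; _∸_; _≤_; _<_; _≤′_; ≤′-refl; ≤′-step; z≤n; s≤s)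
open import Data.Nat.Properties
  using (≤ᵇ⇒≤; ≤⇒≤ᵇ; ≤⇒≤′; <-cmp; ∸-cancelˡ-≡; ≤-refl; ≤-trans; ≤-reflexive; +-comm; m≤n+m)
open import Data.Product using (∃; _×_; _,_; proj₁; proj₂)
open import Data.Sum as Sum using (_⊎_; inj₁; inj₂)
open import Data.Vec using (lookup; tabulate)
open import Data.Vec.Properties using (lookup∘tabulate; []=⇒lookup; lookup⇒[]=)
open import Function using (_∘_; id)
open import Function.Bundles using (Equivalence)
open import Relation.Binary using (tri<; tri≈; tri>)
open import Relation.Binary.PropositionalEquality using (_≡_; _≢_; sym; trans; cong; subst)
open import Relation.Nullary using (¬_; ¬?; yes; no; contradiction)
open import Relation.Nullary.Decidable using (_×-dec_; decidable-stable)

open Equivalence using (to; from)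

private
  variable
    n : ℕ

⊆⊎∃∈∉ : (p q : Subset n) → p ⊆ q ⊎ ∃ λ x → x ∈ p × x ∉ q
⊆⊎∃∈∉ p q with any? (λ x → x ∈? p ×-dec ¬? (x ∈? q))
... | yes witness = inj₂ witness
... | no none = inj₁ λ {x} x∈p → decidable-stable (x ∈? q) (λ x∉q → none (x , x∈p , x∉q))

≢⊤⇒∃∉ : (p : Subset n) → p ≢ ⊤ → ∃ λ x → x ∉ p
≢⊤⇒∃∉ p p≢⊤ with ⊆⊎∃∈∉ ⊤ p
... | inj₁ ⊤⊆p = contradiction (⊆-antisym ⊆⊤ ⊤⊆p) p≢⊤
... | inj₂ (x , _ , x∉p) = x , x∉p

∈⇒T-lookup : {p : Subset n} {x : Fin n} → x ∈ p → T (lookup p x)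
∈⇒T-lookup = from T-≡ ∘ []=⇒lookup

T-lookup⇒∈ : {p : Subset n} {x : Fin n} → T (lookup p x) → x ∈ p
T-lookup⇒∈ {p = p} {x} = lookup⇒[]= x p ∘ to T-≡

∈-tabulate⁻ : {f : Fin n → Bool} {x : Fin n} → x ∈ tabulate f → T (f x)
∈-tabulate⁻ {f = f} {x} = subst T (lookup∘tabulate f x) ∘ ∈⇒T-lookup

∈-tabulate⁺ : {f : Fin n → Bool} {x : Fin n} → T (f x) → x ∈ tabulate f
∈-tabulate⁺ {f = f} {x} = T-lookup⇒∈ ∘ subst T (sym (lookup∘tabulate f x))

∈N⇒adj : (G : Graph n) {u v : Fin n} → u ∈ N G v → adj G v u ≡ true
∈N⇒adj G = to T-≡ ∘ ∈-tabulate⁻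

module Step (G : Graph n) (r : ℕ) where

  ∈-step⁻ : {I : Subset n} {v : Fin n} → v ∈ step G r I → v ∈ I ⊎ r ≤ ∣ N G v ∩ I ∣
  ∈-step⁻ = Sum.map T-lookup⇒∈ (≤ᵇ⇒≤ r _) ∘ to T-∨ ∘ ∈-tabulate⁻

  ∈-step⁺ : {I : Subset n} {v : Fin n} → v ∈ I ⊎ r ≤ ∣ N G v ∩ I ∣ → v ∈ step G r I
  ∈-step⁺ = ∈-tabulate⁺ ∘ from T-∨ ∘ Sum.map ∈⇒T-lookup ≤⇒≤ᵇ

  step-inflationary : {I : Subset n} → I ⊆ step G r I
  step-inflationary = ∈-step⁺ ∘ inj₁

  newcomer-threshold : {I : Subset n} {v : Fin n} → v ∉ I → v ∈ step G r I → r ≤ ∣ N G v ∩ I ∣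
  newcomer-threshold v∉I v∈ with ∈-step⁻ v∈
  ... | inj₁ v∈I = contradiction v∈I v∉I
  ... | inj₂ enough = enough

  outsider-below-threshold : {I : Subset n} {v : Fin n} → v ∉ step G r I → ¬ r ≤ ∣ N G v ∩ I ∣
  outsider-below-threshold v∉ = v∉ ∘ ∈-step⁺ ∘ inj₂

  neighbour-gain : {I I′ : Subset n} {v : Fin n} →
                   r ≤ ∣ N G v ∩ I′ ∣ → ¬ r ≤ ∣ N G v ∩ I ∣ →
                   ∃ λ u → adj G v u ≡ true × u ∈ I′ × u ∉ I
  neighbour-gain {I} {I′} {v} many few with ⊆⊎∃∈∉ (N G v ∩ I′) (N G v ∩ I)
  ... | inj₁ ⊆ = contradiction (≤-trans many (p⊆q⇒∣p∣≤∣q∣ ⊆)) few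
  ... | inj₂ (u , u∈ , u∉) with x∈p∩q⁻ _ _ u∈
  ...   | u∈N , u∈I′ = u , ∈N⇒adj G u∈N , u∈I′ , λ u∈I → u∉ (x∈p∩q⁺ (u∈N , u∈I))

  ∩⊥-below-threshold : 1 ≤ r → (p : Subset n) → ¬ r ≤ ∣ p ∩ ⊥ ∣
  ∩⊥-below-threshold 1≤r p r≤ with ≤-trans 1≤r (≤-trans r≤ (≤-reflexive ∣p∩⊥∣≡0))
    where
    ∣p∩⊥∣≡0 : ∣ p ∩ ⊥ ∣ ≡ 0
    ∣p∩⊥∣≡0 = trans (cong ∣_∣ (∩-zeroʳ p)) (∣⊥∣≡0 n)
  ... | ()

  newcomer-has-infected-neighbour : {I : Subset n} {v : Fin n} → 1 ≤ r →
                                    v ∉ I → v ∈ step G r I → ∃ λ u → adj G v u ≡ true × u ∈ I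
  newcomer-has-infected-neighbour {v = v} 1≤r v∉I v∈
    with neighbour-gain {I = ⊥} (newcomer-threshold v∉I v∈) (∩⊥-below-threshold 1≤r (N G v))
  ... | u , adj-vu , u∈I , _ = u , adj-vu , u∈I

  newcomer-has-newcomer-neighbour : {I : Subset n} {v : Fin n} →
                                    v ∉ step G r I → v ∈ step G r (step G r I) →
                                    ∃ λ u → adj G v u ≡ true × u ∈ step G r I × u ∉ I
  newcomer-has-newcomer-neighbour v∉ v∈ =
    neighbour-gain (newcomer-threshold v∉ v∈) (outsider-below-threshold v∉)

module Descent (G : Graph n) (Level : ℕ → Fin n → Set)
  (descend : ∀ {t v} → Level (suc t) v → ∃ λ u → adj G v u ≡ true × Level t u)
  (level-unique : ∀ {s t v} → Level s v → Level t v → s ≡ t) where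

  chain : ∀ t v → Level t v → Fin (suc t) → Fin n
  chain t v _ zero = v
  chain (suc t) v lv (suc i) = chain t (proj₁ (descend lv)) (proj₂ (proj₂ (descend lv))) i

  chain-level : ∀ t v (lv : Level t v) i → Level (t ∸ toℕ i) (chain t v lv i)
  chain-level t v lv zero = lv
  chain-level (suc t) v lv (suc i) = chain-level t _ _ i

  chain-edges : ∀ t v (lv : Level t v) (i : Fin t) →
                adj G (chain t v lv (inject₁ i)) (chain t v lv (suc i)) ≡ true
  chain-edges (suc t) v lv zero = proj₁ (proj₂ (descend lv))
  chain-edges (suc t) v lv (suc i) = chain-edges t _ _ i

  chain-injective : ∀ t v (lv : Level t v) {i j} → chain t v lv i ≡ chain t v lv j → i ≡ j
  chain-injective t v lv {i} {j} eq =
    toℕ-injective (∸-cancelˡ-≡ (toℕ≤pred[n] i) (toℕ≤pred[n] j)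
      (level-unique (chain-level t v lv i) (subst (Level (t ∸ toℕ j)) (sym eq) (chain-level t v lv j))))

  descent-path : ∀ {t v} → Level t v → Path G t
  descent-path {t} {v} lv = record
    { vert = chain t v lv
    ; distinct = chain-injective t v lv
    ; edges = chain-edges t v lv
    }

module Rounds (G : Graph n) (r : ℕ) (A0 : Subset n) where

  open Step G r

  infectedAfter : ℕ → Subset n
  infectedAfter t = infected G r A0 (suc t)

  infectedAfter-mono′ : ∀ {s t} → s ≤′ t → infectedAfter s ⊆ infectedAfter t
  infectedAfter-mono′ ≤′-refl = id
  infectedAfter-mono′ (≤′-step s≤′t) = step-inflationary ∘ infectedAfter-mono′ s≤′t

  infectedAfter-mono : ∀ {s t} → s ≤ t → infectedAfter s ⊆ infectedAfter t
  infectedAfter-mono = infectedAfter-mono′ ∘ ≤⇒≤′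

  FirstInfectedAfter : ℕ → Fin n → Set
  FirstInfectedAfter zero v = v ∈ A0
  FirstInfectedAfter (suc t) v = v ∈ infectedAfter (suc t) × v ∉ infectedAfter t

  first-infected-∈ : ∀ {t v} → FirstInfectedAfter t v → v ∈ infectedAfter t
  first-infected-∈ {zero} v∈ = v∈
  first-infected-∈ {suc t} (v∈ , _) = v∈

  first-infected-∉ : ∀ {s t v} → FirstInfectedAfter t v → s < t → v ∉ infectedAfter s
  first-infected-∉ {t = suc t} (_ , v∉) (s≤s s≤t) = v∉ ∘ infectedAfter-mono s≤t

  first-infected-unique : ∀ {s t v} → FirstInfectedAfter s v → FirstInfectedAfter t v → s ≡ t
  first-infected-unique {s} {t} fs ft with <-cmp s t
  ... | tri< s<t _ _ = contradiction (first-infected-∈ fs) (first-infected-∉ ft s<t)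
  ... | tri≈ _ s≡t _ = s≡t
  ... | tri> _ _ t<s = contradiction (first-infected-∈ ft) (first-infected-∉ fs t<s)

  first-infected-descend : 1 ≤ r → ∀ {t v} → FirstInfectedAfter (suc t) v →
                           ∃ λ u → adj G v u ≡ true × FirstInfectedAfter t u
  first-infected-descend 1≤r {zero} (v∈ , v∉) = newcomer-has-infected-neighbour 1≤r v∉ v∈
  first-infected-descend 1≤r {suc t} (v∈ , v∉) = newcomer-has-newcomer-neighbour v∉ v∈

  last-round-has-first-infected : ∀ {m} → PercolatesIn G r A0 (suc (suc m)) →
                                  ∃ (FirstInfectedAfter (suc m))
  last-round-has-first-infected {m} (_ , all-infected , not-yet) with ≢⊤⇒∃∉ _ (not-yet (suc m) (s≤s z≤n) ≤-refl)
  ... | v , v∉ = v , subst (v ∈_) (sym all-infected) ∈⊤ , v∉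

mainTheorem10 : ∀ {n : ℕ} (G : Graph n) (r : ℕ) (A0 : Subset n) (k d : ℕ) →
    1 ≤ r → Connected G → PercolatesIn G r A0 k → IsDetourDiameter G d →
    k ≤ d + 1
mainTheorem10 G r A0 zero d _ _ (() , _) _
mainTheorem10 G r A0 (suc zero) d _ _ _ _ = m≤n+m 1 d
mainTheorem10 G r A0 (suc (suc m)) d 1≤r _ percolates (_ , longest) =
  ≤-trans (s≤s (longest (suc m) (descent-path first))) (≤-reflexive (+-comm 1 d))
  where
  open Rounds G r A0
  open Descent G FirstInfectedAfter (first-infected-descend 1≤r) first-infected-unique
  first : FirstInfectedAfter (suc m) (proj₁ (last-round-has-first-infected percolates))
  first = proj₂ (last-round-has-first-infected percolates)
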